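{- For any connected graph $G$ of order $n\geq 2$, $$\gamma_t(M(G\circ P_2))=2n.$$
   Context: All graphs are finite and simple. The $2$-corona $G\circ P_2$ is the graph of order $3|V(G)|$ obtained from $G$ by attaching to each vertex $v$ of $G$ a path of length $2$ (i.e. two new vertices $a_v,b_v$ with edges $va_v$ and $a_vb_v$), so that these paths are vertex-disjoint. For a graph $H$ with no isolated vertices, a total dominating set of $H$ is a set $S\subseteq V(H)$ such that every vertex of $H$ has at least one neighbor in $S$; $\gamma_t(H)$ is the minimum cardinality of a total dominating set. The middle graph $M(G)$ of a graph $G$ has vertex set $V(G)\cup E(G)$ (disjoint union), and two of its vertices $x,y$ are adjacent exactly when either $x,y\in E(G)$ are edges of $G$ sharing a common endpoint, or $x\in V(G)$, $y\in E(G)$ and $x$ is an endpoint of $y$ (no two elements of $V(G)$ are adjacent in $M(G)$). -}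

module Defs where

open import Data.Nat using (ℕ; _≤_)
open import Data.Bool using (Bool; true; false)
open import Data.Fin using (Fin; zero; suc; remQuot; _<_; _≟_)
open import Data.Product using (Σ; _×_; _,_)
open import Data.Sum using (_⊎_)
open import Data.Empty using (⊥)
open import Data.List using (List; length)
open import Data.List.Membership.Propositional using (_∈_)
open import Data.List.Relation.Unary.Unique.Propositional using (Unique)
open import Relation.Nullary using (¬_; does)
open import Relation.Binary.PropositionalEquality using (_≡_)

record Graph (n : ℕ) : Set where
  field
    adj    : Fin n → Fin n → Bool
    sym    : ∀ u v → adj u v ≡ adj v u
    irrefl : ∀ v → adj v v ≡ false
open Graph public

data Reach {n : ℕ} (G : Graph n) : Fin n → Fin n → Set where
  here : ∀ {u} → Reach G u u
  step : ∀ {u v w} → adj G u v ≡ true → Reach G v w → Reach G u w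

Connected : ∀ {n} → Graph n → Set
Connected G = ∀ u v → Reach G u v

-- Vertex combine v i
-- (i.e. remQuot 3 x = (v , i)) is: v itself for i = 0, a_v for i = 1,
-- b_v for i = 2.  Edges: G-edges between original vertices, v a_v, a_v b_v.
coronaAdj' : ∀ {n} → Graph n → Fin n × Fin 3 → Fin n × Fin 3 → Bool
coronaAdj' G (v , zero)           (w , zero)           = adj G v w
coronaAdj' G (v , zero)           (w , suc zero)       = does (v ≟ w)
coronaAdj' G (v , suc zero)       (w , zero)           = does (v ≟ w)
coronaAdj' G (v , suc zero)       (w , suc (suc zero)) = does (v ≟ w)
coronaAdj' G (v , suc (suc zero)) (w , suc zero)       = does (v ≟ w)
coronaAdj' G _                    _                    = false

coronaAdj : ∀ {n} → Graph n → Fin (n Data.Nat.* 3) → Fin (n Data.Nat.* 3) → Bool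
coronaAdj {n} G x y = coronaAdj' G (remQuot 3 x) (remQuot 3 y)

-- Middle graph of a simple graph on Fin m given by a symmetric
-- irreflexive adjacency a.  An edge {u,v} is represented canonically as
-- the ordered pair (u , v) with u < v.
Edge : ∀ {m} → (Fin m → Fin m → Bool) → Set
Edge {m} a = Σ (Fin m × Fin m) λ { (u , v) → u < v × a u v ≡ true }

MV : ∀ {m} → (Fin m → Fin m → Bool) → Set
MV {m} a = Fin m ⊎ Edge a

MAdj : ∀ {m} (a : Fin m → Fin m → Bool) → MV a → MV a → Set
MAdj a (Data.Sum.inj₁ x) (Data.Sum.inj₁ y) = ⊥
MAdj a (Data.Sum.inj₁ x) (Data.Sum.inj₂ ((u , v) , _)) = x ≡ u ⊎ x ≡ v
MAdj a (Data.Sum.inj₂ ((u , v) , _)) (Data.Sum.inj₁ x) = x ≡ u ⊎ x ≡ v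
MAdj a (Data.Sum.inj₂ ((u , v) , _)) (Data.Sum.inj₂ ((u' , v') , _)) =
  ¬ (u ≡ u' × v ≡ v') × (u ≡ u' ⊎ u ≡ v' ⊎ v ≡ u' ⊎ v ≡ v')

IsTDS : {V : Set} → (V → V → Set) → List V → Set
IsTDS {V} Adj S = ∀ (x : V) → Σ V λ y → y ∈ S × Adj x y

TotalDominationNumberIs : {V : Set} → (V → V → Set) → ℕ → Set
TotalDominationNumberIs {V} Adj k =
  (Σ (List V) λ S → Unique S × IsTDS Adj S × length S ≡ k)
  × (∀ (S : List V) → Unique S → IsTDS Adj S → k ≤ length S)

-- The 2n edges v a_v and a_v b_v (v ∈ V(G)) form a total dominating set of
-- M(G ∘ P₂): original and path vertices lie on one of them, a G-edge uv meets
-- v a_v, each v a_v meets a_v b_v and vice versa.  Conversely let T be any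
-- total dominating set.  The vertex b_v of M has only a_v b_v as neighbour, so
-- a_v b_v ∈ T, and a_v b_v needs a neighbour z_v ∈ T in turn.  Both elements
-- touch the path {a_v, b_v}, and every element of M touching that path lives
-- "at v" (its endpoints lie in {v, a_v, b_v}); hence the 2n elements a_v b_v,
-- z_v are pairwise distinct, z_v ≠ a_v b_v because M has no loops.
module Submission where

open import Defs hiding (sym)
open import Data.Nat using (ℕ; _≤_; _*_; z<s; s<s)
import Data.Nat as ℕ
open import Data.Nat.Properties using (+-monoʳ-<)
open import Data.Bool using (Bool; true)
open import Data.Fin using (Fin; suc; combine; remQuot; toℕ; _<_; _≟_)
open import Data.Fin.Patterns using (0F; 1F; 2F)
open import Data.Fin.Properties
  using (remQuot-combine; combine-remQuot; combine-injectiveˡ; combine-injectiveʳ; toℕ-combine; injective⇒≤; *↔×)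
open import Data.Product using (Σ; ∃-syntax; _×_; _,_; proj₁; proj₂; uncurry)
open import Data.Sum using (_⊎_; inj₁; inj₂) renaming (map to ⊎-map)
open import Data.List using (List; length; map; allFin; lookup)
open import Data.List.Properties using (length-map; length-tabulate)
open import Data.List.Membership.Propositional using (_∈_)
open import Data.List.Membership.Propositional.Properties using (∈-map⁺; ∈-allFin)
open import Data.List.Relation.Unary.Any using (index)
open import Data.List.Relation.Unary.Any.Properties using (lookup-index)
open import Data.List.Relation.Unary.Unique.Propositional.Properties using (map⁺; allFin⁺)
open import Function using (_∘_; id; _↔_; Inverse)
open import Function.Definitions using (Injective)
open import Relation.Nullary using (¬_; Dec; does; yes; no; contradiction)
open import Relation.Nullary.Decidable using (dec-true)
open import Relation.Binary.PropositionalEquality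
  using (_≡_; _≢_; refl; sym; trans; cong; subst; subst₂; module ≡-Reasoning)

does⇒ : ∀ {P : Set} (P? : Dec P) → does P? ≡ true → P
does⇒ (yes p) _ = p
does⇒ (no _) ()

combine-monoʳ-< : ∀ {m k} (i : Fin m) {j l : Fin k} → j < l → combine i j < combine i l
combine-monoʳ-< {k = k} i {j} {l} j<l =
  subst₂ ℕ._<_ (sym (toℕ-combine i j)) (sym (toℕ-combine i l)) (+-monoʳ-< (k * toℕ i) j<l)

remQuot≡⇒≡combine : ∀ {m} k {x : Fin (m * k)} {i j} → remQuot {m} k x ≡ (i , j) → x ≡ combine i j
remQuot≡⇒≡combine {m} k {x} eq = trans (sym (combine-remQuot {m} k x)) (cong (uncurry combine) eq)

injective⇒≤-length : ∀ {A : Set} {k} {xs : List A} (f : Fin k → A) →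
                     Injective _≡_ _≡_ f → (∀ i → f i ∈ xs) → k ≤ length xs
injective⇒≤-length {k = k} {xs} f f-injective f∈xs = injective⇒≤ position-injective
  where
  position : Fin k → Fin (length xs)
  position i = index (f∈xs i)

  position-injective : Injective _≡_ _≡_ position
  position-injective {i} {j} eq = f-injective (begin
    f i                   ≡⟨ lookup-index (f∈xs i) ⟩
    lookup xs (position i) ≡⟨ cong (lookup xs) eq ⟩
    lookup xs (position j) ≡⟨ lookup-index (f∈xs j) ⟨
    f j                   ∎)
    where open ≡-Reasoning

module _ {V : Set} (Adj : V → V → Set) where

  image-IsTDS : ∀ {k} (f : Fin k → V) → (∀ x → ∃[ i ] Adj x (f i)) → IsTDS Adj (map f (allFin k))
  image-IsTDS f dominated x = let (i , x~fi) = dominated x in f i , ∈-map⁺ f (∈-allFin i) , x~fi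

  totalDominationNumberIs-intro :
    ∀ {k} {I : Set} (enum : Fin k ↔ I) (f : I → V) → Injective _≡_ _≡_ f →
    (∀ x → ∃[ i ] Adj x (f i)) →
    (∀ T → IsTDS Adj T → Σ (I → V) λ g → Injective _≡_ _≡_ g × (∀ i → g i ∈ T)) →
    TotalDominationNumberIs Adj k
  totalDominationNumberIs-intro {k} enum f f-injective dominated forced =
    (map (f ∘ to) (allFin k) , map⁺ (∘to-injective f f-injective) (allFin⁺ k) ,
      image-IsTDS (f ∘ to) dominated∘to , trans (length-map (f ∘ to) (allFin k)) (length-tabulate id)) ,
    λ T _ T-tds → let (g , g-injective , g∈T) = forced T T-tds
                  in injective⇒≤-length (g ∘ to) (∘to-injective g g-injective) (g∈T ∘ to)
    where
    open Inverse enum using (to; from; strictlyInverseˡ; strictlyInverseʳ)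

    ∘to-injective : (h : _ → V) → Injective _≡_ _≡_ h → Injective _≡_ _≡_ (h ∘ to)
    ∘to-injective h h-injective {i} {j} eq =
      trans (sym (strictlyInverseʳ i)) (trans (cong from (h-injective eq)) (strictlyInverseʳ j))

    dominated∘to : ∀ x → ∃[ i ] Adj x (f (to i))
    dominated∘to x = let (i , x~fi) = dominated x
                     in from i , subst (Adj x ∘ f) (sym (strictlyInverseˡ i)) x~fi

module _ {m} (a : Fin m → Fin m → Bool) where

  Touches : (Fin m → Set) → MV a → Set
  Touches P (inj₁ x)             = P x
  Touches P (inj₂ ((u , v) , _)) = P u ⊎ P v

  Within : (Fin m → Set) → MV a → Set
  Within P (inj₁ x)             = P x
  Within P (inj₂ ((u , v) , _)) = P u × P v

  MAdj-irrefl : ∀ z → ¬ MAdj a z z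
  MAdj-irrefl (inj₂ _) (not-same , _) = not-same (refl , refl)

  MAdj-Within⇒Touches : ∀ {P} y z → Within P y → MAdj a y z → Touches P z
  MAdj-Within⇒Touches (inj₁ x) (inj₂ _) Px x∈z = ⊎-map (λ { refl → Px }) (λ { refl → Px }) x∈z
  MAdj-Within⇒Touches (inj₂ _) (inj₁ x) (Pu , Pv) (inj₁ refl) = Pu
  MAdj-Within⇒Touches (inj₂ _) (inj₁ x) (Pu , Pv) (inj₂ refl) = Pv
  MAdj-Within⇒Touches (inj₂ _) (inj₂ _) (Pu , Pv) (_ , inj₁ refl)               = inj₁ Pu
  MAdj-Within⇒Touches (inj₂ _) (inj₂ _) (Pu , Pv) (_ , inj₂ (inj₁ refl))        = inj₂ Pu
  MAdj-Within⇒Touches (inj₂ _) (inj₂ _) (Pu , Pv) (_ , inj₂ (inj₂ (inj₁ refl))) = inj₁ Pv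
  MAdj-Within⇒Touches (inj₂ _) (inj₂ _) (Pu , Pv) (_ , inj₂ (inj₂ (inj₂ refl))) = inj₂ Pv

module Corona {n : ℕ} (G : Graph n) where

  A : Fin (n * 3) → Fin (n * 3) → Bool
  A = coronaAdj G

  M : Set
  M = MV A

  vtx : Fin n → Fin 3 → Fin (n * 3)
  vtx = combine

  base : Fin (n * 3) → Fin n
  base x = proj₁ (remQuot {n} 3 x)

  OnPath : Fin n → Fin (n * 3) → Set
  OnPath v x = ∃[ i ] remQuot {n} 3 x ≡ (v , suc i)

  position≢ : ∀ {x v w i j} → remQuot {n} 3 x ≡ (w , j) → j ≢ i → x ≢ vtx v i
  position≢ {v = v} {i = i} x-at j≢i x≡vi =
    j≢i (cong proj₂ (trans (sym x-at) (trans (cong (remQuot 3) x≡vi) (remQuot-combine v i))))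

  path-neighbour-base : ∀ v (i : Fin 2) s → coronaAdj' G (v , suc i) s ≡ true → proj₁ s ≡ v
  path-neighbour-base v 0F (w , 0F) v≟w = sym (does⇒ (v ≟ w) v≟w)
  path-neighbour-base v 0F (w , 2F) v≟w = sym (does⇒ (v ≟ w) v≟w)
  path-neighbour-base v 1F (w , 1F) v≟w = sym (does⇒ (v ≟ w) v≟w)

  tip-neighbourʳ : ∀ v s → coronaAdj' G (v , 2F) s ≡ true → s ≡ (v , 1F)
  tip-neighbourʳ v (w , 1F) v≟w = cong (_, 1F) (sym (does⇒ (v ≟ w) v≟w))

  tip-neighbourˡ : ∀ v s → coronaAdj' G s (v , 2F) ≡ true → s ≡ (v , 1F)
  tip-neighbourˡ v (w , 1F) w≟v = cong (_, 1F) (does⇒ (w ≟ v) w≟v)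
  tip-neighbourˡ v (w , 2F) ()

  root-adjacent : ∀ v → A (vtx v 0F) (vtx v 1F) ≡ true
  root-adjacent v rewrite remQuot-combine {n} {3} v 0F | remQuot-combine {n} {3} v 1F = dec-true (v ≟ v) refl

  path-adjacent : ∀ v → A (vtx v 1F) (vtx v 2F) ≡ true
  path-adjacent v rewrite remQuot-combine {n} {3} v 1F | remQuot-combine {n} {3} v 2F = dec-true (v ≟ v) refl

  rootEdge pathEdge : Fin n → Edge A
  rootEdge v = (vtx v 0F , vtx v 1F) , combine-monoʳ-< v z<s , root-adjacent v
  pathEdge v = (vtx v 1F , vtx v 2F) , combine-monoʳ-< v (s<s z<s) , path-adjacent v

  attachedEdge : Fin 2 × Fin n → M
  attachedEdge (0F , v) = inj₂ (pathEdge v)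
  attachedEdge (1F , v) = inj₂ (rootEdge v)

  lowerEnd : M → Fin (n * 3)
  lowerEnd (inj₁ x)             = x
  lowerEnd (inj₂ ((p , _) , _)) = p

  attachedEdge-injective : Injective _≡_ _≡_ attachedEdge
  attachedEdge-injective {0F , v} {0F , w} eq = cong (0F ,_) (combine-injectiveˡ v 1F w 1F (cong lowerEnd eq))
  attachedEdge-injective {0F , v} {1F , w} eq = contradiction (combine-injectiveʳ v 1F w 0F (cong lowerEnd eq)) λ ()
  attachedEdge-injective {1F , v} {0F , w} eq = contradiction (combine-injectiveʳ v 0F w 1F (cong lowerEnd eq)) λ ()
  attachedEdge-injective {1F , v} {1F , w} eq = cong (1F ,_) (combine-injectiveˡ v 0F w 0F (cong lowerEnd eq))

  vertex-dominated : ∀ x → ∃[ i ] MAdj A (inj₁ x) (attachedEdge i)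
  vertex-dominated x with remQuot {n} 3 x in x-at
  ... | v , 0F = (1F , v) , inj₁ (remQuot≡⇒≡combine 3 x-at)
  ... | v , 1F = (1F , v) , inj₂ (remQuot≡⇒≡combine 3 x-at)
  ... | v , 2F = (0F , v) , inj₂ (remQuot≡⇒≡combine 3 x-at)

  edge-dominated : ∀ {p q} (p<q : p < q) (p~q : A p q ≡ true) →
                   ∃[ i ] MAdj A (inj₂ ((p , q) , p<q , p~q)) (attachedEdge i)
  edge-dominated {p} {q} p<q p~q = by-position (remQuot 3 p) (remQuot 3 q) refl refl p~q
    where
    by-position : ∀ r s → remQuot 3 p ≡ r → remQuot 3 q ≡ s → coronaAdj' G r s ≡ true →
                  ∃[ i ] MAdj A (inj₂ ((p , q) , p<q , p~q)) (attachedEdge i)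
    by-position (v , 0F) (w , 0F) p-at q-at _ =
      (1F , v) , (λ (_ , q≡) → position≢ q-at (λ ()) q≡) , inj₁ (remQuot≡⇒≡combine 3 p-at)
    by-position (v , 0F) (w , 1F) p-at q-at _ =
      (0F , w) , (λ (p≡ , _) → position≢ p-at (λ ()) p≡) , inj₂ (inj₂ (inj₁ (remQuot≡⇒≡combine 3 q-at)))
    by-position (v , 1F) (w , 0F) p-at q-at _ =
      (0F , v) , (λ (_ , q≡) → position≢ q-at (λ ()) q≡) , inj₁ (remQuot≡⇒≡combine 3 p-at)
    by-position (v , 1F) (w , 2F) p-at q-at _ =
      (1F , v) , (λ (p≡ , _) → position≢ p-at (λ ()) p≡) , inj₂ (inj₁ (remQuot≡⇒≡combine 3 p-at))
    by-position (v , 2F) (w , 1F) p-at q-at _ =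
      (1F , w) , (λ (p≡ , _) → position≢ p-at (λ ()) p≡) , inj₂ (inj₂ (inj₂ (remQuot≡⇒≡combine 3 q-at)))

  attachedEdges-dominate : ∀ z → ∃[ i ] MAdj A z (attachedEdge i)
  attachedEdges-dominate (inj₁ x)               = vertex-dominated x
  attachedEdges-dominate (inj₂ (_ , p<q , p~q)) = edge-dominated p<q p~q

  tip-OnPath : ∀ v → OnPath v (vtx v 2F)
  tip-OnPath v = 1F , remQuot-combine v 2F

  owner : M → Fin n
  owner (inj₁ x)             = base x
  owner (inj₂ ((_ , q) , _)) = base q

  owner-Touches-path : ∀ v z → Touches A (OnPath v) z → owner z ≡ v
  owner-Touches-path v (inj₁ x) (_ , x-at) = cong proj₁ x-at
  owner-Touches-path v (inj₂ ((p , q) , _ , p~q)) (inj₁ (i , p-at)) =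
    path-neighbour-base v i (remQuot 3 q) (subst (λ r → coronaAdj' G r (remQuot 3 q) ≡ true) p-at p~q)
  owner-Touches-path v (inj₂ _) (inj₂ (_ , q-at)) = cong proj₁ q-at

  tip-neighbour-Within-path : ∀ v y → MAdj A (inj₁ (vtx v 2F)) y → Within A (OnPath v) y
  tip-neighbour-Within-path v (inj₂ ((_ , q) , _ , p~q)) (inj₁ refl) =
    tip-OnPath v ,
    (0F , tip-neighbourʳ v _ (subst (λ r → coronaAdj' G r (remQuot 3 q) ≡ true) (remQuot-combine v 2F) p~q))
  tip-neighbour-Within-path v (inj₂ ((p , _) , _ , p~q)) (inj₂ refl) =
    (0F , tip-neighbourˡ v _ (subst (λ r → coronaAdj' G (remQuot 3 p) r ≡ true) (remQuot-combine v 2F) p~q)) ,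
    tip-OnPath v

  module Forced (T : List M) (T-tds : IsTDS (MAdj A) T) where

    dominator : M → M
    dominator z = proj₁ (T-tds z)

    dominator-∈ : ∀ z → dominator z ∈ T
    dominator-∈ z = proj₁ (proj₂ (T-tds z))

    dominator-adjacent : ∀ z → MAdj A z (dominator z)
    dominator-adjacent z = proj₂ (proj₂ (T-tds z))

    -- forced (0F , v) is the neighbour of b_v in T, necessarily a_v b_v.
    forced : Fin 2 × Fin n → M
    forced (0F , v) = dominator (inj₁ (vtx v 2F))
    forced (1F , v) = dominator (forced (0F , v))

    forced-∈ : ∀ i → forced i ∈ T
    forced-∈ (0F , v) = dominator-∈ (inj₁ (vtx v 2F))
    forced-∈ (1F , v) = dominator-∈ (forced (0F , v))

    owner-forced : ∀ i → owner (forced i) ≡ proj₂ i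
    owner-forced (0F , v) = owner-Touches-path v (forced (0F , v))
      (MAdj-Within⇒Touches A (inj₁ (vtx v 2F)) _ (tip-OnPath v) (dominator-adjacent (inj₁ (vtx v 2F))))
    owner-forced (1F , v) = owner-Touches-path v (forced (1F , v))
      (MAdj-Within⇒Touches A (forced (0F , v)) _ forced₀-Within-path (dominator-adjacent (forced (0F , v))))
      where
      forced₀-Within-path : Within A (OnPath v) (forced (0F , v))
      forced₀-Within-path = tip-neighbour-Within-path v _ (dominator-adjacent (inj₁ (vtx v 2F)))

    forced-injective : Injective _≡_ _≡_ forced
    forced-injective {b , v} {b′ , w} eq
      with trans (sym (owner-forced (b , v))) (trans (cong owner eq) (owner-forced (b′ , w)))
    forced-injective {0F , v} {0F , v} eq | refl = refl
    forced-injective {1F , v} {1F , v} eq | refl = refl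
    forced-injective {0F , v} {1F , v} eq | refl =
      contradiction (subst (MAdj A _) (sym eq) (dominator-adjacent (forced (0F , v)))) (MAdj-irrefl A _)
    forced-injective {1F , v} {0F , v} eq | refl =
      contradiction (subst (MAdj A _) eq (dominator-adjacent (forced (0F , v)))) (MAdj-irrefl A _)

theorem4p6 : (n : ℕ) (G : Graph n) → 2 ≤ n → Connected G →
    TotalDominationNumberIs (MAdj (coronaAdj G)) (2 * n)
theorem4p6 n G _ _ =
  totalDominationNumberIs-intro (MAdj A) *↔× attachedEdge attachedEdge-injective attachedEdges-dominate
    λ T T-tds → let open Forced T T-tds in forced , forced-injective , forced-∈
  where open Corona G
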